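{- Let $d\ge 3$, let $G$ be a finite connected non-bipartite $d$-regular graph, and let $S$ be a multiset of non-negative integers, not all zero, such that the girth of $G$ is larger than $3\max(S)$. Then the polygraph $G_S$ is connected and non-bipartite.
   Context: With $\rho$ the graph metric of $G$ and $S=[l_1,\dots,l_m]$, $G_S$ has vertex set $V(G)^m$, and $(x_1,\dots,x_m)\sim(y_1,\dots,y_m)$ iff $[\rho(x_1,y_1),\dots,\rho(x_m,y_m)]=S$ as multisets. -}

module Defs where

open import Data.Nat using (ℕ; zero; suc; _+_; _≤_; _⊔_)
open import Data.Fin using (Fin; zero; suc; inject₁; fromℕ)
open import Data.Bool using (Bool; true; false; T; if_then_else_)
open import Data.List using (List; foldr; map; length; tabulate; allFin)
open import Data.Nat.ListAction using (sum)
open import Data.List.Relation.Binary.Permutation.Propositional using (_↭_)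
open import Data.Product using (Σ; ∃; _×_)
open import Relation.Binary.PropositionalEquality using (_≡_; _≢_)
open import Function.Definitions using (Injective)

record Graph : Set where
  field
    n      : ℕ
    adj    : Fin n → Fin n → Bool
    sym    : ∀ x y → adj x y ≡ adj y x
    irrefl : ∀ x → adj x x ≡ false

module _ (G : Graph) where
  open Graph G

  Vtx : Set
  Vtx = Fin n

  Edge : Vtx → Vtx → Set
  Edge x y = T (adj x y)

  degree : Vtx → ℕ
  degree x = sum (map (λ y → if adj x y then 1 else 0) (allFin n))

  Regular : ℕ → Set
  Regular d = ∀ x → degree x ≡ d

  IsCycle : (j : ℕ) → (Fin (3 + j) → Vtx) → Set
  IsCycle j vs =
    Injective _≡_ _≡_ vs
    × (∀ (i : Fin (2 + j)) → Edge (vs (inject₁ i)) (vs (suc i)))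
    × Edge (vs (fromℕ (2 + j))) (vs zero)

  -- girth of G is larger than g (vacuous if G has no cycles: girth = ∞)
  GirthGreaterThan : ℕ → Set
  GirthGreaterThan g = ∀ j (vs : Fin (3 + j) → Vtx) → IsCycle j vs → g < 3 + j
    where open import Data.Nat using (_<_)

module _ {V : Set} (R : V → V → Set) where

  data Walk : V → V → ℕ → Set where
    here : ∀ {x} → Walk x x 0
    step : ∀ {x y z k} → R x y → Walk y z k → Walk x z (suc k)

  Connected : Set
  Connected = ∀ x y → ∃ λ k → Walk x y k

  Bipartite : Set
  Bipartite = Σ (V → Bool) λ c → ∀ x y → R x y → c x ≢ c y

Dist : (G : Graph) → Vtx G → Vtx G → ℕ → Set
Dist G x y k = Walk (Edge G) x y k × (∀ j → Walk (Edge G) x y j → k ≤ j)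

maxL : List ℕ → ℕ
maxL = foldr _⊔_ 0

-- The polygraph G_S: vertices are m-tuples (m = |S|) of vertices of G,
-- (x_i) ~ (y_i) iff the multiset [ρ(x_i,y_i)]_i equals S.
PolyVtx : Graph → List ℕ → Set
PolyVtx G S = Fin (length S) → Vtx G

PolyAdj : (G : Graph) (S : List ℕ) → PolyVtx G S → PolyVtx G S → Set
PolyAdj G S xs ys =
  Σ (Fin (length S) → ℕ) λ ks →
    (∀ i → Dist G (xs i) (ys i) (ks i)) × (tabulate ks ↭ S)

-- Write L = max S. When the girth exceeds 2L, a non-backtracking walk of length at most L
-- is a shortest path: together with a shorter walk back it would reduce to a non-empty closed
-- non-backtracking walk of length at most 2L, which contains a short cycle. Minimum degree 3
-- lets such walks be extended indefinitely, so for every x–u–y in G and 1 ≤ l ≤ L there is a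
-- vertex z with ρ(x,z) = ρ(z,y) = l (leave u through a third neighbour). Hence in G_S any one
-- coordinate can move two steps along G in two steps of G_S, carrying a positive entry of S
-- while every other coordinate goes out and back. Since G is connected and non-bipartite, any
-- two vertices of G are joined by a walk of even length, so G_S joins any two tuples by an even
-- walk, one coordinate at a time; an edge of G_S followed by an even walk back is then an odd
-- closed walk.

module Submission where

open import Defs
open import Data.Nat using (ℕ; zero; suc; _+_; _*_; _≥_; _≤_; _<_; z≤n; s≤s; _≤?_)
open import Data.Nat.Properties
open import Data.Nat.ListAction using (sum)
open import Algebra.Properties.CommutativeSemigroup +-commutativeSemigroup using (interchange)
open import Data.Fin using (Fin; zero; suc; toℕ; fromℕ; inject₁; inject≤)
open import Data.Fin.Properties using (any?; toℕ<n; toℕ-inject≤; toℕ-inject₁; inject≤-injective) renaming (_≟_ to _≟ᶠ_)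
open import Data.Bool using (Bool; true; false; not; _xor_; T; if_then_else_)
open import Data.Bool.Properties using (T?; ¬-not; not-¬; not-distribˡ-xor; not-distribʳ-xor; xor-same; xor-identityʳ; xor-comm) renaming (_≟_ to _≟ᵇ_)
open import Data.Empty using (⊥-elim)
open import Data.Unit using (tt)
open import Data.Sum using (_⊎_; inj₁; inj₂)
open import Data.Product using (Σ; ∃; _×_; _,_; proj₁; proj₂)
open import Data.List using (List; []; _∷_; tabulate; lookup; length; allFin)
open import Data.List.Properties using (map-tabulate; tabulate-lookup)
open import Data.List.Membership.Propositional using (_∉_)
open import Data.List.Membership.Propositional.Properties using (∈-allFin)
open import Data.List.Relation.Unary.All using (All; []; _∷_) renaming (map to All-map)
open import Data.List.Relation.Unary.All.Properties using (tabulate⁻; ¬All⇒Any¬)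
import Data.List.Relation.Unary.Any as Any
open import Data.List.Relation.Unary.Any.Properties using (lookup-index)
open import Data.List.Relation.Binary.Permutation.Propositional using (_↭_; ↭-refl; ↭-reflexive; ↭-sym; ↭-trans; prep; swap; module PermutationReasoning)
open import Data.List.Relation.Binary.Permutation.Propositional.Properties using (drop-mid; All-resp-↭)
open import Data.Vec.Functional using (updateAt)
open import Data.Vec.Functional.Properties using (updateAt-updates; updateAt-minimal; updateAt-id-local; updateAt-updateAt-local)
open import Function using (_∘_; id; const)
open import Function.Definitions using (Injective)
open import Relation.Nullary using (¬_; Dec; does; yes; no; contradiction)
open import Relation.Nullary.Decidable using (dec-true; _×-dec_; ¬?)
open import Relation.Binary.PropositionalEquality

odd : ℕ → Bool
odd zero = false
odd (suc zero) = true
odd (suc (suc n)) = odd n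

odd-suc : ∀ n → odd (suc n) ≡ not (odd n)
odd-suc zero = refl
odd-suc (suc zero) = refl
odd-suc (suc (suc n)) = odd-suc n

odd-+ : ∀ m n → odd (m + n) ≡ odd m xor odd n
odd-+ zero n = refl
odd-+ (suc zero) n = odd-suc n
odd-+ (suc (suc m)) n = odd-+ m n

module _ {V : Set} {R : V → V → Set} where

  infixr 5 _++ʷ_

  _++ʷ_ : ∀ {x y z j k} → Walk R x y j → Walk R y z k → Walk R x z (j + k)
  here ++ʷ v = v
  step e w ++ʷ v = step e (w ++ʷ v)

  snoc : ∀ {x y z k} → Walk R x y k → R y z → Walk R x z (suc k)
  snoc here e = step e here
  snoc (step f w) e = step f (snoc w e)

  reverse : (∀ {x y} → R x y → R y x) → ∀ {x y k} → Walk R x y k → Walk R y x k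
  reverse R-sym here = here
  reverse R-sym (step e w) = snoc (reverse R-sym w) (R-sym e)

  colour-along : (c : V → Bool) → (∀ x y → R x y → c x ≢ c y) →
                 ∀ {x y k} → Walk R x y k → c y ≡ c x xor odd k
  colour-along c proper {x} here = sym (xor-identityʳ (c x))
  colour-along c proper {x} (step {y = y} {k = k} e w) = begin
    _                      ≡⟨ colour-along c proper w ⟩
    c y xor odd k          ≡⟨ cong (_xor odd k) (¬-not (proper x y e ∘ sym)) ⟩
    not (c x) xor odd k    ≡⟨ sym (not-distribˡ-xor (c x) (odd k)) ⟩
    not (c x xor odd k)    ≡⟨ not-distribʳ-xor (c x) (odd k) ⟩
    c x xor not (odd k)    ≡⟨ cong (c x xor_) (sym (odd-suc k)) ⟩
    c x xor odd (suc k)    ∎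
    where open ≡-Reasoning

  oddClosedWalk⇒¬Bipartite : ∀ {x k} → Walk R x x k → odd k ≡ true → ¬ Bipartite R
  oddClosedWalk⇒¬Bipartite {x} w odd-k (c , proper) =
    not-¬ refl (trans (colour-along c proper w) (trans (cong (c x xor_) odd-k) (xor-comm (c x) true)))

module _ {V : Set} (R : V → V → Set) where

  WalkOfParity : Bool → V → V → Set
  WalkOfParity b x y = Σ ℕ λ k → odd k ≡ b × Walk R x y k

module _ {V : Set} {R : V → V → Set} where

  infixr 5 _++ᵖ_

  _++ᵖ_ : ∀ {b c x y z} → WalkOfParity R b x y → WalkOfParity R c y z →
          WalkOfParity R (b xor c) x z
  (j , refl , v) ++ᵖ (k , refl , w) = j + k , odd-+ j k , v ++ʷ w

sum-tabulate-≤ : ∀ {n} (f g : Fin n → ℕ) → (∀ i → f i ≤ g i) → sum (tabulate f) ≤ sum (tabulate g)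
sum-tabulate-≤ {zero} f g f≤g = z≤n
sum-tabulate-≤ {suc n} f g f≤g =
  +-mono-≤ (f≤g zero) (sum-tabulate-≤ (f ∘ suc) (g ∘ suc) (f≤g ∘ suc))

sum-tabulate-+ : ∀ {n} (f g : Fin n → ℕ) →
                 sum (tabulate (λ i → f i + g i)) ≡ sum (tabulate f) + sum (tabulate g)
sum-tabulate-+ {zero} f g = refl
sum-tabulate-+ {suc n} f g =
  trans (cong ((f zero + g zero) +_) (sum-tabulate-+ (f ∘ suc) (g ∘ suc)))
        (interchange (f zero) (g zero) (sum (tabulate (f ∘ suc))) (sum (tabulate (g ∘ suc))))

δ : ∀ {n} → Fin n → Fin n → ℕ
δ a i = if does (i ≟ᶠ a) then 1 else 0

δ-diag : ∀ {n} (a : Fin n) → δ a a ≡ 1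
δ-diag a = cong (if_then 1 else 0) (dec-true (a ≟ᶠ a) refl)

sum-tabulate-0 : ∀ n → sum (tabulate {n = n} (const 0)) ≡ 0
sum-tabulate-0 zero = refl
sum-tabulate-0 (suc n) = sum-tabulate-0 n

sum-δ : ∀ {n} (a : Fin n) → sum (tabulate (δ a)) ≡ 1
sum-δ {suc n} zero = cong suc (sum-tabulate-0 n)
sum-δ {suc n} (suc a) = sum-δ a

maxL-upper : ∀ xs → All (_≤ maxL xs) xs
maxL-upper [] = []
maxL-upper (x ∷ xs) =
  m≤m⊔n x (maxL xs) ∷ All-map (λ l≤ → ≤-trans l≤ (m≤n⊔m x (maxL xs))) (maxL-upper xs)

update-↭ : ∀ {A : Set} {m} (f : Fin m → A) i x →
           f i ∷ tabulate (updateAt f i (const x)) ↭ x ∷ tabulate f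
update-↭ f zero x = swap (f zero) x ↭-refl
update-↭ f (suc i) x =
  ↭-trans (swap _ _ ↭-refl) (↭-trans (prep (f zero) (update-↭ (f ∘ suc) i x)) (swap _ _ ↭-refl))

entry-to-position : ∀ {A : Set} {m} (f : Fin m → A) (i k : Fin m) →
                    Σ (Fin m → A) λ a → tabulate a ↭ tabulate f × a i ≡ f k
entry-to-position f i k = a , drop-mid [] [] a↭f , updateAt-updates i g
  where
  g = updateAt f k (const (f i))
  a = updateAt g i (const (f k))
  g-i : g i ≡ f i
  g-i with i ≟ᶠ k
  ... | yes refl = updateAt-updates i f
  ... | no i≢k = updateAt-minimal i k f i≢k
  a↭f : f i ∷ tabulate a ↭ f i ∷ tabulate f
  a↭f = begin
    f i ∷ tabulate a ≡⟨ cong (_∷ tabulate a) (sym g-i) ⟩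
    g i ∷ tabulate a ↭⟨ update-↭ g i (f k) ⟩
    f k ∷ tabulate g ↭⟨ update-↭ f k (f i) ⟩
    f i ∷ tabulate f ∎
    where open PermutationReasoning

module _ (G : Graph) where

  private
    V : Set
    V = Vtx G

    E : V → V → Set
    E = Edge G

  edge-sym : ∀ {x y} → E x y → E y x
  edge-sym {x} {y} = subst T (Graph.sym G x y)

  edge-irrefl : ∀ {x} → ¬ E x x
  edge-irrefl {x} = subst T (Graph.irrefl G x)

  Dist-refl : ∀ {x} → Dist G x x 0
  Dist-refl = here , λ _ _ → z≤n

  Dist-sym : ∀ {x y l} → Dist G x y l → Dist G y x l
  Dist-sym (w , minimal) = reverse edge-sym w , λ j v → minimal j (reverse edge-sym v)

  vertices : ∀ {x y k} → Walk E x y k → Fin (suc k) → V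
  vertices {x} here _ = x
  vertices {x} (step _ _) zero = x
  vertices (step _ w) (suc i) = vertices w i

  vertices-head : ∀ {x y k} (w : Walk E x y k) → vertices w zero ≡ x
  vertices-head here = refl
  vertices-head (step _ _) = refl

  vertices-last : ∀ {x y k} (w : Walk E x y k) → vertices w (fromℕ k) ≡ y
  vertices-last here = refl
  vertices-last (step _ w) = vertices-last w

  vertices-edge : ∀ {x y k} (w : Walk E x y k) (i : Fin k) →
                  E (vertices w (inject₁ i)) (vertices w (suc i))
  vertices-edge (step e w) zero = subst (E _) (sym (vertices-head w)) e
  vertices-edge (step _ w) (suc i) = vertices-edge w i

  prefix : ∀ {x y k} (w : Walk E x y k) (i : Fin (suc k)) → Walk E x (vertices w i) (toℕ i)
  prefix here zero = here
  prefix (step _ _) zero = here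
  prefix (step e w) (suc i) = step e (prefix w i)

  vertices-prefix : ∀ {x y k} (w : Walk E x y k) (i : Fin (suc k)) (p : Fin (suc (toℕ i))) →
                    vertices (prefix w i) p ≡ vertices w (inject≤ p (toℕ<n i))
  vertices-prefix here zero zero = refl
  vertices-prefix (step _ _) zero zero = refl
  vertices-prefix (step _ _) (suc i) zero = refl
  vertices-prefix (step _ w) (suc i) (suc p) = vertices-prefix w i p

  data NonBacktracking : ∀ {x y k} → Walk E x y k → Set where
    nb-here : ∀ {x} → NonBacktracking (here {x = x})
    nb-edge : ∀ {x y} (e : E x y) → NonBacktracking (step e here)
    nb-step : ∀ {x y z w k} {e : E x y} {f : E y z} {p : Walk E z w k} →
              x ≢ z → NonBacktracking (step f p) → NonBacktracking (step e (step f p))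

  nb-tail : ∀ {x y z k} {e : E x y} {w : Walk E y z k} → NonBacktracking (step e w) → NonBacktracking w
  nb-tail (nb-edge _) = nb-here
  nb-tail (nb-step _ nb) = nb

  Cycle≤ : ℕ → Set
  Cycle≤ k = Σ ℕ λ j → Σ (Fin (3 + j) → V) λ vs → IsCycle G j vs × 3 + j ≤ k

  path-closing-cycle : ∀ {x v j} (P : Walk E x v (2 + j)) → Injective _≡_ _≡_ (vertices P) → E v x →
                       IsCycle G j (vertices P)
  path-closing-cycle P distinct e =
    distinct , vertices-edge P , subst₂ E (sym (vertices-last P)) (sym (vertices-head P)) e

  -- If x reappears as vertex t of the path w, then x followed by the first t vertices of w is a
  -- cycle; t ≥ 2 because E is irreflexive and step e w does not backtrack.
  revisit-cycle : ∀ {x y z k} (e : E x y) (w : Walk E y z k) → NonBacktracking (step e w) →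
                  Injective _≡_ _≡_ (vertices w) → ∀ t → vertices w t ≡ x → Cycle≤ (suc k)
  revisit-cycle e w _ _ zero w₀≡x = ⊥-elim (edge-irrefl (subst (E _) (trans (sym (vertices-head w)) w₀≡x) e))
  revisit-cycle e here _ _ (suc ()) _
  revisit-cycle e (step f w) (nb-step x≢z _) _ (suc zero) w₁≡x = ⊥-elim (x≢z (trans (sym w₁≡x) (vertices-head w)))
  revisit-cycle {x} e w _ distinct (suc (suc t)) wt≡x =
    toℕ (inject₁ t) , vertices P , path-closing-cycle P P-distinct closing , length-bound
    where
    P : Walk E x (vertices w (inject₁ (suc t))) (2 + toℕ (inject₁ t))
    P = step e (prefix w (inject₁ (suc t)))

    closing : E (vertices w (inject₁ (suc t))) x
    closing = subst (E _) wt≡x (vertices-edge w (suc t))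

    on-w : ∀ q → vertices (prefix w (inject₁ (suc t))) q ≡ vertices w (inject≤ q (toℕ<n (inject₁ (suc t))))
    on-w = vertices-prefix w (inject₁ (suc t))

    too-early : ∀ q → vertices (prefix w (inject₁ (suc t))) q ≢ x
    too-early q q≡x = 1+n≰n (begin
      3 + toℕ t           ≡⟨ cong suc (sym toℕ-q) ⟩
      suc (toℕ q)         ≤⟨ toℕ<n q ⟩
      2 + toℕ (inject₁ t) ≡⟨ cong (2 +_) (toℕ-inject₁ t) ⟩
      2 + toℕ t           ∎)
      where
      open ≤-Reasoning
      toℕ-q : toℕ q ≡ 2 + toℕ t
      toℕ-q = trans (sym (toℕ-inject≤ q _)) (cong toℕ (distinct (trans (sym (on-w q)) (trans q≡x (sym wt≡x)))))

    P-distinct : Injective _≡_ _≡_ (vertices P)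
    P-distinct {zero} {zero} _ = refl
    P-distinct {zero} {suc q} x≡ = ⊥-elim (too-early q (sym x≡))
    P-distinct {suc p} {zero} ≡x = ⊥-elim (too-early p ≡x)
    P-distinct {suc p} {suc q} eq =
      cong suc (inject≤-injective _ _ p q (distinct (trans (sym (on-w p)) (trans eq (on-w q)))))

    length-bound : 3 + toℕ (inject₁ t) ≤ suc _
    length-bound = ≤-trans (≤-reflexive (cong (3 +_) (toℕ-inject₁ t))) (toℕ<n (suc (suc t)))

  path-or-cycle : ∀ {x y k} (w : Walk E x y k) → NonBacktracking w →
                  Injective _≡_ _≡_ (vertices w) ⊎ Cycle≤ k
  path-or-cycle here _ = inj₁ λ { {zero} {zero} _ → refl }
  path-or-cycle {x} (step e w) nb with path-or-cycle w (nb-tail nb)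
  ... | inj₂ (j , vs , cycle , short) = inj₂ (j , vs , cycle , m≤n⇒m≤1+n short)
  ... | inj₁ distinct with any? (λ t → vertices w t ≟ᶠ x)
  ...   | yes (t , wt≡x) = inj₂ (revisit-cycle e w nb distinct t wt≡x)
  ...   | no x∉w = inj₁ distinct′
    where
    distinct′ : Injective _≡_ _≡_ (vertices (step e w))
    distinct′ {zero} {zero} _ = refl
    distinct′ {zero} {suc q} x≡ = ⊥-elim (x∉w (q , sym x≡))
    distinct′ {suc p} {zero} ≡x = ⊥-elim (x∉w (p , ≡x))
    distinct′ {suc p} {suc q} eq = cong suc (distinct eq)

  GirthGreaterThan-mono : ∀ {g g′} → g′ ≤ g → GirthGreaterThan G g → GirthGreaterThan G g′
  GirthGreaterThan-mono g′≤g girth j vs cycle = ≤-<-trans g′≤g (girth j vs cycle)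

  girth<closedNonBacktracking : ∀ {g x k} → GirthGreaterThan G g →
                                (C : Walk E x x (suc k)) → NonBacktracking C → g < suc k
  girth<closedNonBacktracking {k = k} girth C nb with path-or-cycle C nb
  ... | inj₁ distinct
    with distinct {zero} {fromℕ (suc k)} (trans (vertices-head C) (sym (vertices-last C)))
  ...   | ()
  girth<closedNonBacktracking girth C nb | inj₂ (j , vs , cycle , short) =
    <-≤-trans (girth j vs cycle) short

  prepend-edge : ∀ {t c x s} → E t c → (S : Walk E c x s) → NonBacktracking S →
                 Σ ℕ λ s′ → Σ (Walk E t x s′) NonBacktracking × s ≤ suc s′ × s′ ≤ suc s
  prepend-edge e here _ = 1 , (step e here , nb-edge e) , z≤n , ≤-refl
  prepend-edge {t} e (step {y = c₁} {k = s} f S) nb with t ≟ᶠ c₁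
  ... | yes refl = s , (S , nb-tail nb) , ≤-refl , m≤n⇒m≤1+n (n≤1+n s)
  ... | no t≢c₁ =
    suc (suc s) , (step e (step f S) , nb-step t≢c₁ nb) , m≤n⇒m≤1+n (n≤1+n (suc s)) , ≤-refl

  prepend-walk : ∀ {t c x s u} → Walk E t c u → (S : Walk E c x s) → NonBacktracking S →
                 Σ ℕ λ s′ → Σ (Walk E t x s′) NonBacktracking × s ≤ s′ + u × s′ ≤ s + u
  prepend-walk {s = s} here S nb = s , (S , nb) , m≤m+n s 0 , m≤m+n s 0
  prepend-walk {s = s} (step {k = u} e U) S nb with prepend-walk U S nb
  ... | s₁ , (S₁ , nb₁) , s≤s₁+u , s₁≤s+u with prepend-edge e S₁ nb₁
  ...   | s′ , S′ , s₁≤1+s′ , s′≤1+s₁ =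
    s′ , S′ , ≤-trans s≤s₁+u (≤-trans (+-monoˡ-≤ u s₁≤1+s′) (≤-reflexive (sym (+-suc s′ u)))) ,
              ≤-trans s′≤1+s₁ (≤-trans (s≤s s₁≤s+u) (≤-reflexive (sym (+-suc s u))))

  nonBacktracking⇒Dist : ∀ {L z x a} → GirthGreaterThan G (L + L) →
                         (W : Walk E z x a) → NonBacktracking W → a ≤ L → Dist G z x a
  nonBacktracking⇒Dist {a = a} girth W nb a≤L = W , minimal
    where
    -- A shorter walk V, reversed and prepended to W, cancels to a closed non-backtracking walk of
    -- length between 1 and 2L.
    minimal : ∀ j → Walk E _ _ j → a ≤ j
    minimal j V with a ≤? j
    ... | yes a≤j = a≤j
    ... | no a≰j with prepend-walk (reverse edge-sym V) W nb
    ...   | zero , _ , a≤j , _ = contradiction a≤j a≰j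
    ...   | suc _ , (C , nbC) , _ , s′≤a+j = ⊥-elim (<⇒≱ (girth<closedNonBacktracking girth C nbC)
            (≤-trans s′≤a+j (+-mono-≤ a≤L (≤-trans (<⇒≤ (≰⇒> a≰j)) a≤L))))

  degree≤2 : ∀ {c a b} → (∀ y → E c y → y ≡ a ⊎ y ≡ b) → degree G c ≤ 2
  degree≤2 {c} {a} {b} neighbours = begin
    degree G c                                      ≡⟨ cong sum (map-tabulate id indicator) ⟩
    sum (tabulate indicator)                        ≤⟨ sum-tabulate-≤ indicator _ indicator≤δ ⟩
    sum (tabulate (λ y → δ a y + δ b y))            ≡⟨ sum-tabulate-+ (δ a) (δ b) ⟩
    sum (tabulate (δ a)) + sum (tabulate (δ b))     ≡⟨ cong₂ _+_ (sum-δ a) (sum-δ b) ⟩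
    2                                               ∎
    where
    open ≤-Reasoning
    indicator : V → ℕ
    indicator y = if Graph.adj G c y then 1 else 0
    indicator≤δ : ∀ y → indicator y ≤ δ a y + δ b y
    indicator≤δ y with Graph.adj G c y in adj≡
    ... | false = z≤n
    ... | true with neighbours y (subst T (sym adj≡) tt)
    ...   | inj₁ refl = ≤-trans (≤-reflexive (sym (δ-diag a))) (m≤m+n _ _)
    ...   | inj₂ refl = ≤-trans (≤-reflexive (sym (δ-diag b))) (m≤n+m _ _)

  fresh-neighbour : ∀ {c} → 3 ≤ degree G c → ∀ a b → ∃ λ y → E c y × y ≢ a × y ≢ b
  fresh-neighbour {c} deg≥3 a b
    with any? (λ y → T? (Graph.adj G c y) ×-dec ¬? (y ≟ᶠ a) ×-dec ¬? (y ≟ᶠ b))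
  ... | yes found = found
  ... | no none = ⊥-elim (<⇒≱ deg≥3 (degree≤2 among-a-b))
    where
    among-a-b : ∀ y → E c y → y ≡ a ⊎ y ≡ b
    among-a-b y e with y ≟ᶠ a | y ≟ᶠ b
    ... | yes y≡a | _ = inj₁ y≡a
    ... | no _ | yes y≡b = inj₂ y≡b
    ... | no y≢a | no y≢b = ⊥-elim (none (y , e , y≢a , y≢b))

  module _ (deg≥3 : ∀ x → 3 ≤ degree G x) where

    ray : ∀ {u w} (e : E u w) (r : ℕ) → Σ V λ z → Σ (Walk E w z r) λ Z → NonBacktracking (step e Z)
    ray e zero = _ , here , nb-edge e
    ray {u} {w} e (suc r) with fresh-neighbour (deg≥3 w) u u
    ... | w′ , e′ , w′≢u , _ with ray e′ r
    ...   | z , Z , nb = z , step e′ Z , nb-step (w′≢u ∘ sym) nb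

    module _ {L} (girth : GirthGreaterThan G (L + L)) where

      sphere-point : ∀ x l → l ≤ L → ∃ λ z → Dist G x z l
      sphere-point x zero _ = x , Dist-refl
      sphere-point x (suc r) l≤L with fresh-neighbour (deg≥3 x) x x
      ... | w , e , _ with ray e r
      ...   | z , Z , nb = z , nonBacktracking⇒Dist girth (step e Z) nb l≤L

      common-sphere-point : ∀ {x u y} l → E x u → E u y → 1 ≤ l → l ≤ L →
                            ∃ λ z → Dist G x z l × Dist G z y l
      common-sphere-point 1 e₁ e₂ _ l≤L =
        _ , nonBacktracking⇒Dist girth (step e₁ here) (nb-edge e₁) l≤L ,
            nonBacktracking⇒Dist girth (step e₂ here) (nb-edge e₂) l≤L
      common-sphere-point {x} {u} {y} (suc (suc r)) e₁ e₂ _ l≤L with fresh-neighbour (deg≥3 u) x y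
      ... | w , e , w≢x , w≢y with ray e r
      ...   | z , Z , nb =
        z , nonBacktracking⇒Dist girth (step e₁ (step e Z)) (nb-step (w≢x ∘ sym) nb) l≤L ,
            Dist-sym (nonBacktracking⇒Dist girth (step (edge-sym e₂) (step e Z))
                                                  (nb-step (w≢y ∘ sym) nb) l≤L)

  vertex : ¬ Bipartite E → V
  vertex nonBipartite with any? {n = Graph.n G} (λ _ → yes tt)
  ... | yes (v , _) = v
  ... | no empty = ⊥-elim (nonBipartite (const true , λ x _ _ _ → empty (x , tt)))

  module _ (connected : Connected E) (nonBipartite : ¬ Bipartite E) where

    oddClosedWalk : ∀ x → WalkOfParity E true x x
    oddClosedWalk x =
      from-monochromatic-edge (any? λ u → any? λ w → T? (Graph.adj G u w) ×-dec (colour u ≟ᵇ colour w))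
      where
      colour : V → Bool
      colour v = odd (proj₁ (connected x v))

      from-monochromatic-edge : Dec (∃ λ u → ∃ λ w → E u w × colour u ≡ colour w) →
                                WalkOfParity E true x x
      from-monochromatic-edge (no none) =
        ⊥-elim (nonBipartite (colour , λ u w e same → none (u , w , e , same)))
      from-monochromatic-edge (yes (u , w , e , same)) =
        subst (λ b → WalkOfParity E b x x) odd-length (to-u ++ᵖ (1 , refl , step e here) ++ᵖ from-w)
        where
        to-u : WalkOfParity E (colour u) x u
        to-u = proj₁ (connected x u) , refl , proj₂ (connected x u)
        from-w : WalkOfParity E (colour w) w x
        from-w = proj₁ (connected x w) , refl , reverse edge-sym (proj₂ (connected x w))
        odd-length : colour u xor not (colour w) ≡ true
        odd-length = trans (cong (_xor not (colour w)) same)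
                           (trans (sym (not-distribʳ-xor (colour w) (colour w))) (cong not (xor-same (colour w))))

    evenWalk : ∀ x y → WalkOfParity E false x y
    evenWalk x y with connected x y
    ... | k , w with odd k in odd-k
    ...   | false = k , odd-k , w
    ...   | true = oddClosedWalk x ++ᵖ (k , odd-k , w)

module Polygraph (G : Graph) (S : List ℕ)
                 (girth : GirthGreaterThan G (maxL S + maxL S)) (deg≥3 : ∀ x → 3 ≤ degree G x)
                 (G-connected : Connected (Edge G)) (G-nonBipartite : ¬ Bipartite (Edge G))
                 {k₀ : Fin (length S)} (positive : 1 ≤ lookup S k₀) where

  private
    m : ℕ
    m = length S

    L : ℕ
    L = maxL S

    Tuple : Set
    Tuple = PolyVtx G S

    X₀ : Tuple
    X₀ = const (vertex G G-nonBipartite)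

    _~_ : Tuple → Tuple → Set
    _~_ = PolyAdj G S

  EvenWalk : Tuple → Tuple → Set
  EvenWalk = WalkOfParity _~_ false

  weights-≤ : ∀ {a : Fin m → ℕ} → tabulate a ↭ S → ∀ j → a j ≤ L
  weights-≤ a↭S = tabulate⁻ (All-resp-↭ (↭-sym a↭S) (maxL-upper S))

  lookup↭S : tabulate (lookup S) ↭ S
  lookup↭S = ↭-reflexive (tabulate-lookup S)

  walk₂-via-midpoints : ∀ {X Y} (a : Fin m → ℕ) → tabulate a ↭ S →
                        (∀ j → ∃ λ z → Dist G (X j) z (a j) × Dist G z (Y j) (a j)) → Walk _~_ X Y 2
  walk₂-via-midpoints a a↭S midpoint =
    step (a , proj₁ ∘ proj₂ ∘ midpoint , a↭S) (step (a , proj₂ ∘ proj₂ ∘ midpoint , a↭S) here)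

  round-trip : ∀ {x x′ l} → l ≤ L → x′ ≡ x → ∃ λ z → Dist G x z l × Dist G z x′ l
  round-trip {x} {l = l} l≤L refl with sphere-point G deg≥3 girth x l l≤L
  ... | z , d = z , d , Dist-sym G d

  ≗⇒walk₂ : ∀ {X Y} → X ≗ Y → Walk _~_ X Y 2
  ≗⇒walk₂ X≗Y =
    walk₂-via-midpoints (lookup S) lookup↭S λ j → round-trip (weights-≤ lookup↭S j) (sym (X≗Y j))

  ≗⇒evenWalk : ∀ {X Y} → X ≗ Y → EvenWalk X Y
  ≗⇒evenWalk X≗Y = 2 , refl , ≗⇒walk₂ X≗Y

  step-coordinate : ∀ {X i u y} → Edge G (X i) u → Edge G u y →
                    Walk _~_ X (updateAt X i (const y)) 2
  -- Coordinate i carries the positive entry of S and passes through a common sphere point of its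
  -- endpoints; every other coordinate goes out to a sphere point and returns.
  step-coordinate {X} {i} {y = y} e₁ e₂ with entry-to-position (lookup S) i k₀
  ... | a , a↭ , a-i = walk₂-via-midpoints a a↭S midpoint
    where
    a↭S : tabulate a ↭ S
    a↭S = ↭-trans a↭ lookup↭S
    midpoint : ∀ j → ∃ λ z → Dist G (X j) z (a j) × Dist G z (updateAt X i (const y) j) (a j)
    midpoint j with j ≟ᶠ i
    ... | no j≢i = round-trip (weights-≤ a↭S j) (updateAt-minimal j i X j≢i)
    ... | yes refl with common-sphere-point G deg≥3 girth (a j) e₁ e₂
                          (subst (1 ≤_) (sym a-i) positive) (weights-≤ a↭S j)
    ...   | z , d₁ , d₂ = z , d₁ , subst (λ v → Dist G z v (a j)) (sym (updateAt-updates j X)) d₂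

  walk-coordinate : ∀ {X i a b k} → X i ≡ a → Walk (Edge G) a b k → odd k ≡ false →
                    EvenWalk X (updateAt X i (const b))
  walk-coordinate {X} {i} refl here _ = ≗⇒evenWalk (λ j → sym (updateAt-id-local i X refl j))
  walk-coordinate refl (step e here) ()
  walk-coordinate {X} {i} refl (step e₁ (step e₂ w)) even =
    (2 , refl , step-coordinate e₁ e₂)
      ++ᵖ walk-coordinate (updateAt-updates i X) w even
      ++ᵖ ≗⇒evenWalk (updateAt-updateAt-local i X refl)

  evenWalk-agreeing-off : ∀ {X Y} (is : List (Fin m)) → (∀ j → j ∉ is → X j ≡ Y j) → EvenWalk X Y
  evenWalk-agreeing-off [] agree = ≗⇒evenWalk λ j → agree j λ ()
  evenWalk-agreeing-off {X} {Y} (i ∷ is) agree =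
    let _ , even , w = evenWalk G G-connected G-nonBipartite (X i) (Y i)
    in walk-coordinate refl w even ++ᵖ evenWalk-agreeing-off is agree′
    where
    agree′ : ∀ j → j ∉ is → updateAt X i (const (Y i)) j ≡ Y j
    agree′ j j∉is with j ≟ᶠ i
    ... | yes refl = updateAt-updates j X
    ... | no j≢i = trans (updateAt-minimal j i X j≢i)
                         (agree j λ { (Any.here j≡i) → j≢i j≡i ; (Any.there j∈is) → j∉is j∈is })

  evenWalk-tuples : ∀ X Y → EvenWalk X Y
  evenWalk-tuples X Y = evenWalk-agreeing-off (allFin m) λ j j∉ → ⊥-elim (j∉ (∈-allFin j))

  connected : Connected _~_
  connected X Y with evenWalk-tuples X Y
  ... | k , _ , w = k , w

  nonBipartite : ¬ Bipartite _~_
  nonBipartite with ≗⇒walk₂ {X₀} {X₀} (λ _ → refl)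
  ... | step X₀~Z _ with evenWalk-tuples _ X₀
  ...   | k , even , back = oddClosedWalk⇒¬Bipartite (step X₀~Z back) (trans (odd-suc k) (cong not even))

claim3p4 : (d : ℕ) → d ≥ 3 → (G : Graph) → Connected (Edge G) → ¬ Bipartite (Edge G)
    → Regular G d → (S : List ℕ) → ¬ All (λ l → l ≡ 0) S
    → GirthGreaterThan G (3 * maxL S)
    → Connected (PolyAdj G S) × ¬ Bipartite (PolyAdj G S)
claim3p4 d d≥3 G G-connected G-nonBipartite regular S not-all-zero girth =
  connected , nonBipartite
  where
  L = maxL S
  2L≤3L : L + L ≤ 3 * L
  2L≤3L = +-monoʳ-≤ L (m≤m+n L (L + 0))
  deg≥3 : ∀ x → 3 ≤ degree G x
  deg≥3 x = subst (3 ≤_) (sym (regular x)) d≥3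
  nonzero-entry = ¬All⇒Any¬ (_≟ 0) S not-all-zero
  open Polygraph G S (GirthGreaterThan-mono G 2L≤3L girth) deg≥3 G-connected G-nonBipartite
                 {Any.index nonzero-entry} (n≢0⇒n>0 (lookup-index nonzero-entry))
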